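{- Let $(\mathcal{R},W)$ be a Strip Packing instance and let $\mathcal{F},\mathcal{Q},\mathcal{W}$ be its $\mathcal{FQW}$-partition. Then every $r\in\mathcal{Q}\cup\mathcal{W}$ satisfies $h_r\le\frac12 h_{\mathrm{OPT}}$.
   Context: Strip Packing: an instance $(\mathcal{R},W)$ consists of a strip $[0,W]\times[0,\infty)$ with $W>0$ and a finite set $\mathcal{R}$ of axis-parallel closed rectangles; rectangle $r$ has width $w_r\in(0,W]$ and height $h_r>0$. A packing assigns to each $r$ a lower-left corner $(x_r,y_r)$; it is feasible if $x_r\ge0$, $x_r+w_r\le W$, $y_r\ge0$ and the open rectangles $(x_r,x_r+w_r)\times(y_r,y_r+h_r)$ are pairwise disjoint; no rotations. The height of a packing is $\max_r(y_r+h_r)$ and $h_{\mathrm{OPT}}$ is the minimum height of a feasible packing. $\mathcal{FQW}$-partition: go through the rectangles in order of non-increasing height (ties broken arbitrarily), adding $r$ to $\mathcal{F}$ (initially empty) if and only if $w_r+\sum_{f\in\mathcal{F}}w_f\le W$. Then $\mathcal{W}=\{r\in\mathcal{R}\setminus\mathcal{F}:w_r>W/2\}$ and $\mathcal{Q}=\mathcal{R}\setminus(\mathcal{F}\cup\mathcal{W})$.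
   Formalization: The strip width $W$, the rectangle dimensions $w_r$ and $h_r$, and the corners $(x_r,y_r)$ of packings are rational. -}

module Defs where

open import Data.Nat using (ℕ)
open import Data.Fin using (Fin)
open import Data.List using (List; []; _∷_; foldr; allFin)
open import Data.List.Membership.Propositional using (_∈_)
open import Data.List.Relation.Unary.AllPairs using (AllPairs)
open import Data.List.Relation.Binary.Permutation.Propositional using (_↭_)
open import Data.Rational using (ℚ; 0ℚ; ½; _+_; _*_; _≤_; _<_; _⊔_)
open import Data.Rational.Properties using (_≤?_)
open import Data.Product using (_×_; Σ)
open import Relation.Nullary using (¬_; does)
open import Relation.Binary.PropositionalEquality using (_≡_; _≢_)
open import Data.Bool using (if_then_else_)

record Instance : Set where
  field
    n    : ℕ
    W    : ℚ
    w    : Fin n → ℚ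
    h    : Fin n → ℚ
    W>0  : 0ℚ < W
    w>0  : ∀ i → 0ℚ < w i
    w≤W  : ∀ i → w i ≤ W
    h>0  : ∀ i → 0ℚ < h i

module _ (I : Instance) where
  open Instance I

  -- A packing: lower-left corners (x i , y i).
  record Packing : Set where
    field
      x : Fin n → ℚ
      y : Fin n → ℚ

  open Packing

  Feasible : Packing → Set
  Feasible P =
    (∀ i → 0ℚ ≤ x P i) ×
    (∀ i → x P i + w i ≤ W) ×
    (∀ i → 0ℚ ≤ y P i) ×
    (∀ i j → i ≢ j →
      ¬ ((x P i < x P j + w j) × (x P j < x P i + w i) ×
         (y P i < y P j + h j) × (y P j < y P i + h i)))

  -- height = max over rectangles of y i + h i (0 for the empty instance)
  height : Packing → ℚ
  height P = foldr (λ i m → (y P i + h i) ⊔ m) 0ℚ (allFin n)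

  IsOptHeight : ℚ → Set
  IsOptHeight H =
    Σ Packing (λ P → Feasible P × height P ≡ H) ×
    (∀ P → Feasible P → H ≤ height P)

  -- An admissible processing order: a permutation of all rectangles in
  -- order of non-increasing height (arbitrary tie-breaking).
  IsHeightOrder : List (Fin n) → Set
  IsHeightOrder ord = (ord ↭ allFin n) × AllPairs (λ i j → h j ≤ h i) ord

  -- Greedy selection: s is the total width of rectangles already in F.
  greedy : ℚ → List (Fin n) → List (Fin n)
  greedy s [] = []
  greedy s (r ∷ rs) =
    if does (w r + s ≤? W) then r ∷ greedy (s + w r) rs else greedy s rs

  InF : List (Fin n) → Fin n → Set
  InF ord r = r ∈ greedy 0ℚ ord

  InW : List (Fin n) → Fin n → Set
  InW ord r = ¬ InF ord r × (½ * W < w r)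

  InQ : List (Fin n) → Fin n → Set
  InQ ord r = ¬ InF ord r × ¬ InW ord r

-- Suppose r ∉ F had h r > hOPT / 2. When the greedy pass rejected r, the
-- rectangles already in F were all at least as tall as r, and together with r
-- their widths exceed W. In an optimal packing every rectangle taller than
-- hOPT / 2 crosses the horizontal line y = hOPT / 2, so these rectangles have
-- pairwise disjoint x-ranges inside [0, W], and their widths sum to at most W.

module Submission where

open import Defs
open import Data.Empty using (⊥-elim)
open import Data.Fin using (Fin)
open import Data.List using (List; []; _∷_; _++_; [_]; foldr; filter; length)
open import Data.List.Properties using (length-filter)
open import Data.List.Membership.Propositional using (_∈_; _∉_)
open import Data.List.Membership.Propositional.Properties using (∈-allFin; ∈-∃++)
open import Data.List.Relation.Unary.Any using (here; there)
open import Data.List.Relation.Unary.All as All using (All; []; _∷_)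
import Data.List.Relation.Unary.All.Properties as All
open import Data.List.Relation.Unary.AllPairs using (AllPairs; []; _∷_)
import Data.List.Relation.Unary.AllPairs.Properties as AllPairs
open import Data.List.Relation.Unary.Unique.Propositional using (Unique)
open import Data.List.Relation.Unary.Unique.Propositional.Properties using (allFin⁺)
open import Data.List.Relation.Binary.Sublist.Propositional using (_⊆_; []; _∷_; _∷ʳ_; minimum)
open import Data.List.Relation.Binary.Sublist.Propositional.Properties using (All-resp-⊆; ++⁺)
open import Data.List.Relation.Binary.Permutation.Propositional using (↭-sym; ↭⇒↭ₛ)
open import Data.List.Relation.Binary.Permutation.Propositional.Properties using (∈-resp-↭)
open import Data.List.Relation.Binary.Permutation.Setoid.Properties using (Unique-resp-↭)
open import Data.Nat as ℕ using (suc; s≤s)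
import Data.Nat.Properties as ℕ
open import Data.Product using (_×_; _,_; Σ; proj₁; proj₂)
open import Data.Rational using (ℚ; 0ℚ; ½; _+_; _*_; _≤_; _<_; _⊔_)
open import Data.Rational.Properties
open import Data.Rational.Solver using (module +-*-Solver)
open import Data.Sum using (_⊎_; inj₁; inj₂; [_,_]′)
open import Relation.Nullary using (¬_; yes; no)
open import Relation.Nullary.Decidable using (dec-true; dec-false)
open import Relation.Binary.PropositionalEquality using (_≡_; _≢_; refl; sym; trans; cong; subst)
open import Relation.Binary.PropositionalEquality.Properties using (setoid)
open import Relation.Unary using (Decidable)
open import Relation.Unary.Properties using (∁?)

open +-*-Solver

sumBy : {A : Set} → (A → ℚ) → List A → ℚ
sumBy f []       = 0ℚ
sumBy f (a ∷ as) = f a + sumBy f as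

sumBy-filter : {A : Set} {P : A → Set} (P? : Decidable P) (f : A → ℚ) (xs : List A) →
  sumBy f xs ≡ sumBy f (filter P? xs) + sumBy f (filter (∁? P?) xs)
sumBy-filter P? f [] = refl
sumBy-filter P? f (x ∷ xs) with P? x
... | yes _ = trans (cong (f x +_) (sumBy-filter P? f xs)) (sym (+-assoc (f x) _ _))
... | no _  = trans (cong (f x +_) (sumBy-filter P? f xs))
                    (exchange (f x) (sumBy f (filter P? xs)) (sumBy f (filter (∁? P?) xs)))
  where
  exchange : ∀ a b c → a + (b + c) ≡ b + (a + c)
  exchange = solve 3 (λ a b c → a :+ (b :+ c) := b :+ (a :+ c)) refl

module Intervals {A : Set} (x ℓ : A → ℚ) where

  Disjoint : A → A → Set
  Disjoint i j = x j + ℓ j ≤ x i ⊎ x i + ℓ i ≤ x j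

  Within : ℚ → ℚ → A → Set
  Within a b i = a ≤ x i × x i + ℓ i ≤ b

  -- Induction on a length bound: the intervals left and right of the first one
  -- are recursed on separately.
  disjoint-intervals-fit : ∀ k (is : List A) → length is ℕ.≤ k → ∀ {a b} → a ≤ b →
    All (Within a b) is → AllPairs Disjoint is → a + sumBy ℓ is ≤ b
  disjoint-intervals-fit k [] _ {a} a≤b _ _ = subst (_≤ _) (sym (+-identityʳ a)) a≤b
  disjoint-intervals-fit (suc k) (e ∷ is) (s≤s |is|≤k) {a} {b} _
                         ((a≤e , e≤b) ∷ within) (e#is ∷ disjoint) =
    begin
      a + (ℓ e + sumBy ℓ is)   ≡⟨ cong (λ s → a + (ℓ e + s)) (sumBy-filter left? ℓ is) ⟩
      a + (ℓ e + (L + R))      ≡⟨ rearrange a (ℓ e) L R ⟩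
      a + L + ℓ e + R          ≤⟨ +-monoˡ-≤ R (+-monoˡ-≤ (ℓ e) left-fit) ⟩
      x e + ℓ e + R            ≤⟨ right-fit ⟩
      b                        ∎
    where
    open ≤-Reasoning
    left? : Decidable (λ j → x j + ℓ j ≤ x e)
    left? j = x j + ℓ j ≤? x e
    lefts rights : List A
    lefts = filter left? is
    rights = filter (∁? left?) is
    L R : ℚ
    L = sumBy ℓ lefts
    R = sumBy ℓ rights
    rearrange : ∀ a b c d → a + (b + (c + d)) ≡ a + c + b + d
    rearrange = solve 4 (λ a b c d → a :+ (b :+ (c :+ d)) := a :+ c :+ b :+ d) refl
    left-fit : a + L ≤ x e
    left-fit = disjoint-intervals-fit k lefts (ℕ.≤-trans (length-filter left? is) |is|≤k) a≤e
      (All.zipWith (λ ((a≤j , _) , j≤e) → a≤j , j≤e)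
        (All.filter⁺ left? within , All.all-filter left? is))
      (AllPairs.filter⁺ left? disjoint)
    right-of-e : ∀ {j} → Within a b j × Disjoint e j → ¬ (x j + ℓ j ≤ x e) → Within (x e + ℓ e) b j
    right-of-e ((_ , j≤b) , inj₁ j≤e) j≰e = ⊥-elim (j≰e j≤e)
    right-of-e ((_ , j≤b) , inj₂ e≤j) _   = e≤j , j≤b
    right-fit : x e + ℓ e + R ≤ b
    right-fit = disjoint-intervals-fit k rights (ℕ.≤-trans (length-filter (∁? left?) is) |is|≤k) e≤b
      (All.zipWith (λ (p , q) → right-of-e p q)
        (All.filter⁺ (∁? left?) (All.zip (within , e#is)) , All.all-filter (∁? left?) is))
      (AllPairs.filter⁺ (∁? left?) disjoint)

AllPairs-resp-⊆ : {A : Set} {R : A → A → Set} {xs ys : List A} →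
  xs ⊆ ys → AllPairs R ys → AllPairs R xs
AllPairs-resp-⊆ []             []         = []
AllPairs-resp-⊆ (_ ∷ʳ xs⊆ys)   (_ ∷ Rys)  = AllPairs-resp-⊆ xs⊆ys Rys
AllPairs-resp-⊆ (refl ∷ xs⊆ys) (Ry ∷ Rys) = All-resp-⊆ xs⊆ys Ry ∷ AllPairs-resp-⊆ xs⊆ys Rys

AllPairs-before : {A : Set} {R : A → A → Set} (xs : List A) {y : A} {ys : List A} →
  AllPairs R (xs ++ y ∷ ys) → All (λ x → R x y) xs
AllPairs-before []       _           = []
AllPairs-before (x ∷ xs) (Rx ∷ Rxs) = All.head (All.++⁻ʳ xs Rx) ∷ AllPairs-before xs Rxs

AllPairs-from-Unique : {A : Set} {P : A → Set} {R : A → A → Set} →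
  (∀ {i j} → P i → P j → i ≢ j → R i j) → ∀ {xs} → All P xs → Unique xs → AllPairs R xs
AllPairs-from-Unique R-of []         []             = []
AllPairs-from-Unique R-of (Px ∷ Pxs) (x∉xs ∷ unique) =
  All.zipWith (λ (Py , x≢y) → R-of Px Py x≢y) (Pxs , x∉xs) ∷ AllPairs-from-Unique R-of Pxs unique

≤-foldr-⊔ : {A : Set} (f : A → ℚ) {i : A} {xs : List A} →
  i ∈ xs → f i ≤ foldr (λ j m → f j ⊔ m) 0ℚ xs
≤-foldr-⊔ f (here refl)             = p≤p⊔q _ _
≤-foldr-⊔ f {xs = j ∷ _} (there i∈) = ≤-trans (≤-foldr-⊔ f i∈) (p≤q⊔p (f j) _)

½-+-½ : ∀ H → ½ * H + ½ * H ≡ H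
½-+-½ H = trans (sym (*-distribʳ-+ H ½ ½)) (*-identityˡ H)

straddles-half : ∀ {y h H} → 0ℚ ≤ y → y + h ≤ H → ½ * H < h → y < ½ * H × ½ * H < y + h
straddles-half {y} {h} {H} 0≤y top half<h = below , above
  where
  open ≤-Reasoning
  above : ½ * H < y + h
  above = <-≤-trans half<h (subst (_≤ y + h) (+-identityˡ h) (+-monoˡ-≤ h 0≤y))
  below : y < ½ * H
  below with ½ * H ≤? y
  ... | no half≰y = ≰⇒> half≰y
  ... | yes half≤y = ⊥-elim (<-irrefl refl (begin-strict
    H                  ≡⟨ sym (½-+-½ H) ⟩
    ½ * H + ½ * H      <⟨ +-mono-≤-< half≤y half<h ⟩
    y + h              ≤⟨ top ⟩
    H                  ∎))

module _ (I : Instance) where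
  open Instance I

  greedy-accept : ∀ s a as → w a + s ≤ W → greedy I s (a ∷ as) ≡ a ∷ greedy I (s + w a) as
  greedy-accept s a as fits rewrite dec-true (w a + s ≤? W) fits = refl

  greedy-skip : ∀ s a as → ¬ (w a + s ≤ W) → greedy I s (a ∷ as) ≡ greedy I s as
  greedy-skip s a as ¬fits rewrite dec-false (w a + s ≤? W) ¬fits = refl

  greedy-⊆ : ∀ s as → greedy I s as ⊆ as
  greedy-⊆ s [] = []
  greedy-⊆ s (a ∷ as) with w a + s ≤? W
  ... | yes fits rewrite greedy-accept s a as fits = refl ∷ greedy-⊆ (s + w a) as
  ... | no ¬fits rewrite greedy-skip s a as ¬fits = a ∷ʳ greedy-⊆ s as

  greedy-rejects : ∀ s pre {r} post → r ∉ greedy I s (pre ++ r ∷ post) →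
    W < s + sumBy w (greedy I s pre ++ [ r ])
  greedy-rejects s [] {r} post r∉ with w r + s ≤? W
  ... | yes fits = ⊥-elim (r∉ (subst (r ∈_) (sym (greedy-accept s r post fits)) (here refl)))
  ... | no ¬fits = subst (W <_) (solve 2 (λ s w → w :+ s := s :+ (w :+ con 0ℚ)) refl s (w r))
                     (≰⇒> ¬fits)
  greedy-rejects s (a ∷ pre) {r} post r∉ with w a + s ≤? W
  ... | yes fits rewrite greedy-accept s a pre fits =
    subst (W <_) (+-assoc s (w a) _) (greedy-rejects (s + w a) pre post
      (λ r∈ → r∉ (subst (r ∈_) (sym (greedy-accept s a (pre ++ r ∷ post) fits)) (there r∈))))
  ... | no ¬fits rewrite greedy-skip s a pre ¬fits =
    greedy-rejects s pre post
      (λ r∈ → r∉ (subst (r ∈_) (sym (greedy-skip s a (pre ++ r ∷ post) ¬fits)) r∈))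

  rejected-with-taller : ∀ {ord} → IsHeightOrder I ord → ∀ {r} → ¬ InF I ord r →
    Σ (List (Fin n)) λ T → W < sumBy w T × All (λ j → h r ≤ h j) T × Unique T
  rejected-with-taller {ord} (ord↭ , sorted) {r} r∉F
    with pre , post , refl ← ∈-∃++ (∈-resp-↭ (↭-sym ord↭) (∈-allFin r)) =
    T , subst (W <_) (+-identityˡ _) (greedy-rejects 0ℚ pre post r∉F) , taller , distinct
    where
    T : List (Fin n)
    T = greedy I 0ℚ pre ++ [ r ]
    taller : All (λ j → h r ≤ h j) T
    taller = All.++⁺ (All-resp-⊆ (greedy-⊆ 0ℚ pre) (AllPairs-before pre sorted)) (≤-refl ∷ [])
    distinct : Unique T
    distinct = AllPairs-resp-⊆ (++⁺ (greedy-⊆ 0ℚ pre) (refl ∷ minimum post))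
      (Unique-resp-↭ (setoid _) (↭⇒↭ₛ (↭-sym ord↭)) (allFin⁺ n))

  module _ (P : Packing I) (feasible : Feasible I P) where
    open Packing P
    open Intervals x w

    private
      x≥0 : ∀ i → 0ℚ ≤ x i
      x≥0 = proj₁ feasible
      x+w≤W : ∀ i → x i + w i ≤ W
      x+w≤W = proj₁ (proj₂ feasible)
      y≥0 : ∀ i → 0ℚ ≤ y i
      y≥0 = proj₁ (proj₂ (proj₂ feasible))
      no-overlap : ∀ i j → i ≢ j →
        ¬ ((x i < x j + w j) × (x j < x i + w i) × (y i < y j + h j) × (y j < y i + h i))
      no-overlap = proj₂ (proj₂ (proj₂ feasible))

    Crosses : ℚ → Fin n → Set
    Crosses t i = y i < t × t < y i + h i

    crossing-disjoint : ∀ {t i j} → i ≢ j → Crosses t i → Crosses t j → Disjoint i j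
    crossing-disjoint {t} {i} {j} i≢j (yi<t , t<i) (yj<t , t<j)
      with x i <? x j + w j | x j <? x i + w i
    ... | yes i<j | yes j<i = ⊥-elim (no-overlap i j i≢j
                                (i<j , j<i , <-trans yi<t t<j , <-trans yj<t t<i))
    ... | no i≮j  | _       = inj₁ (≮⇒≥ i≮j)
    ... | yes _   | no j≮i  = inj₂ (≮⇒≥ j≮i)

    tall-crosses-half : ∀ {j} → ½ * height I P < h j → Crosses (½ * height I P) j
    tall-crosses-half {j} = straddles-half (y≥0 j) (≤-foldr-⊔ (λ i → y i + h i) (∈-allFin j))

    tall-rectangles-fit : ∀ {T} → All (λ j → ½ * height I P < h j) T → Unique T → sumBy w T ≤ W
    tall-rectangles-fit {T} tall distinct = subst (_≤ W) (+-identityˡ _)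
      (disjoint-intervals-fit (length T) T ℕ.≤-refl (<⇒≤ W>0)
        (All.tabulate (λ {j} _ → x≥0 j , x+w≤W j))
        (AllPairs-from-Unique
          (λ i-tall j-tall i≢j → crossing-disjoint i≢j (tall-crosses-half i-tall) (tall-crosses-half j-tall))
          tall distinct))

lemma3 : (I : Instance) (ord : List (Fin (Instance.n I))) → IsHeightOrder I ord →
    (hOPT : ℚ) → IsOptHeight I hOPT →
    (r : Fin (Instance.n I)) → InQ I ord r ⊎ InW I ord r →
    Instance.h I r ≤ ½ * hOPT
lemma3 I _ order _ ((P , feasible , refl) , _) r r∈Q∪W
  with Instance.h I r ≤? ½ * height I P | rejected-with-taller I order ([ proj₁ , proj₁ ]′ r∈Q∪W)
... | yes r-short | _ = r-short
... | no  r-tall  | _ , W<T , taller , distinct =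
  ⊥-elim (<-irrefl refl (<-≤-trans W<T
    (tall-rectangles-fit I P feasible (All.map (<-≤-trans (≰⇒> r-tall)) taller) distinct)))
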